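{- Let $t<n/2$ and let $V$ be a value domain. The following two-round protocol solves the $t$-MAd-Authenticated-Byzantine-SM task on $n$ processors against a mobile authenticated Byzantine $t$-MAd adversary. Processor $p_i$ has input $x(i)\in V$. (1) Every $p_i$ sends $x(i)$ to every $p_j$, who denotes the received value $v(i)_j$ (set to a fixed default value of $V$ if nothing was received), and lets $\vec v_j=(v(1)_j,\dots,v(n)_j)$. (2) Every $p_i$ sends $\vec v_i$ to every $p_j$, who denotes the received vector $\vec v_{i\to j}=(v(1)_{i\to j},\dots,v(n)_{i\to j})$, where $\vec v_{i\to j}:=\bot^n$ if what was received is not an element of $V^n$. (3) For every $\ell\in[n]$, $p_j$ sets $y(\ell)_j:=b$ if for some $b\in V$ and some set $I\subseteq[n]$ with $|I|\ge n-t$ we have $v(\ell)_{i\to j}=b$ for all $i\in I$ and $v(\ell)_{i\to j}=\bot$ for all $i\in[n]\setminus I$; otherwise $y(\ell)_j:=\bot$. $p_j$ outputs $\vec y_j=(y(1)_j,\dots,y(n)_j)$.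
   Context: System: $n$ processors run a synchronous round-based protocol; each round every processor sends a (possibly different) message to every processor over dedicated point-to-point channels whose receiver knows the sender identity; messages of round $\rho$ are delivered by the start of round $\rho+1$. A message adversary (MAd) sees all messages and may delete or arbitrarily replace outgoing messages, in a given round, of the processors it corrupts in that round; it never alters internal states, inputs, outputs or incoming messages. Authentication constraint: every message has the form $(p_i,\rho,m)$, and for every message $(p,\rho,m)$ sent in the protocol and every $(p',\rho',m')$ with $\rho'\le\rho$ encoded as a substring of $m$, either $p'$ was corrupted in round $\rho'$ or $p'$ was uncorrupted in round $\rho'$ and actually sent $(p',\rho',m')$ (so claims about messages of uncorrupted (processor, round) pairs cannot be forged, apart from pretending a message was not received). A mobile $t$-MAd adversary corrupts at most $t$ processors in each round, possibly a different set each round. The $t$-MAd-Authenticated-Byzantine-SM task: each $p_i$ has input $x(i)\in V$ and outputs $\vec y_i=(y(1)_i,\dots,y(n)_i)$ with each $y(j)_i\in V\cup\{\bot\}$ such that (a) there is $Ind\subseteq[n]$ with $|Ind|\ge n-t$ such that $y(j)_i=x(j)$ for all $j\in Ind$ and all $i\in[n]$; (b) for all $i,j,\ell$, if $y(\ell)_i\ne\bot$ and $y(\ell)_j\ne\bot$ then $y(\ell)_i=y(\ell)_j$. These conditions apply to all processors, corrupted or not. -}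

module Defs where

open import Data.Nat using (ℕ; _≤_; _∸_)
open import Data.Fin using (Fin)
open import Data.Fin.Subset using (Subset; _∈_; _∉_; ∣_∣)
open import Data.Maybe using (Maybe; just; nothing; maybe)
open import Data.Product using (Σ; _×_)
open import Data.Sum using (_⊎_)
open import Relation.Nullary using (¬_)
open import Relation.Binary.PropositionalEquality using (_≡_)

-- An execution of the two-round protocol on n processors with inputs x,
-- against a mobile authenticated Byzantine t-MAd adversary.
-- ⊥ is represented by 'nothing'.
record Execution (n t : ℕ) (V : Set) (x : Fin n → V) : Set where
  field
    -- sets of processors corrupted in round 1 and in round 2
    C₁ C₂ : Subset n
    C₁-size : ∣ C₁ ∣ ≤ t
    C₂-size : ∣ C₂ ∣ ≤ t
    -- round 1: v i j = v(i)_j, the value p_j records as received from p_i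
    -- (arbitrary, including the default value, if p_i corrupted in round 1)
    v : Fin n → Fin n → V
    v-honest : ∀ i j → i ∉ C₁ → v i j ≡ x i
    -- round 2: recv i j = vector p_j records as received from p_i;
    -- 'nothing' stands for ⊥^n (nothing received / not an element of V^n)
    recv : Fin n → Fin n → Maybe (Fin n → V)
    recv-honest : ∀ i j → i ∉ C₂ → recv i j ≡ just (λ k → v k i)
    -- authentication: a (forged) vector from a round-2-corrupted sender
    -- cannot misreport the round-1 message of a round-1-uncorrupted processor
    recv-auth : ∀ i j w → i ∈ C₂ → recv i j ≡ just w →
                ∀ k → k ∉ C₁ → w k ≡ x k

module _ {n t : ℕ} {V : Set} {x : Fin n → V} (E : Execution n t V x) where
  open Execution E

  entry : Fin n → Fin n → Fin n → Maybe V
  entry i j ℓ = maybe (λ w → just (w ℓ)) nothing (recv i j)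

  Cond : Fin n → Fin n → V → Set
  Cond j ℓ b = Σ (Subset n) λ I → (n ∸ t ≤ ∣ I ∣)
                 × (∀ i → i ∈ I → entry i j ℓ ≡ just b)
                 × (∀ i → i ∉ I → entry i j ℓ ≡ nothing)

  OutputRule : Fin n → Fin n → Maybe V → Set
  OutputRule j ℓ y = (Σ V λ b → Cond j ℓ b × y ≡ just b)
                   ⊎ ((¬ Σ V (Cond j ℓ)) × y ≡ nothing)

-- the t-MAd-Authenticated-Byzantine-SM task; y i ℓ = y(ℓ)_i
SolvesSM : (n t : ℕ) {V : Set} → (Fin n → V) → (Fin n → Fin n → Maybe V) → Set
SolvesSM n t x y =
  (Σ (Subset n) λ Ind → (n ∸ t ≤ ∣ Ind ∣)
     × (∀ j → j ∈ Ind → ∀ i → y i j ≡ just (x j)))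
  × (∀ i j ℓ b b′ → y i ℓ ≡ just b → y j ℓ ≡ just b′ → b ≡ b′)

-- Every vector a round-2-uncorrupted sender k relays is honest, and k exists
-- since t < n; k is never ⊥ in step (3), so any value b passing step (3) at
-- coordinate ℓ equals v(ℓ)_k, the same for all receivers: this is agreement.
-- If p_ℓ is uncorrupted in round 1, authentication forces every non-⊥ report
-- of its message to be x(ℓ), and the senders of non-⊥ vectors include the
-- at least n − t round-2-uncorrupted ones, so step (3) outputs x(ℓ): this is
-- validity with Ind the complement of the round-1-corrupted set.
module Submission where

open import Defs
open import Data.Nat using (ℕ; _*_; _<_; _≤_; _∸_; s≤s)
open import Data.Nat.Properties using (≤-trans; ≤-<-trans; m≤m+n; ∸-monoʳ-≤)
open import Data.Fin using (Fin; zero; suc)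
open import Data.Fin.Subset using (Subset; _∈_; _∉_; ∣_∣; ∁; inside; outside)
open import Data.Fin.Subset.Properties using (_∈?_; ∣∁p∣≡n∸∣p∣; x∈∁p⇒x∉p; p⊆q⇒∣p∣≤∣q∣)
open import Data.Maybe using (Maybe; just; nothing; is-just)
open import Data.Maybe.Properties using (just-injective)
open import Data.Vec using (_∷_; tabulate; there)
open import Data.Vec.Properties using (lookup∘tabulate; []=⇒lookup; lookup⇒[]=)
open import Data.Product using (∃; _,_)
open import Data.Sum using (inj₁; inj₂)
open import Data.Empty using (⊥-elim)
open import Function using (_∘_)
open import Relation.Nullary using (yes; no)
open import Relation.Binary.PropositionalEquality using (_≡_; refl; sym; trans; cong; subst)

module _ {n : ℕ} {A : Set} where

  support : (Fin n → Maybe A) → Subset n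
  support f = tabulate (is-just ∘ f)

  just⇒∈support : ∀ {f k a} → f k ≡ just a → k ∈ support f
  just⇒∈support {f} {k} eq =
    lookup⇒[]= k (support f) (trans (lookup∘tabulate (is-just ∘ f) k) (cong is-just eq))

  ∈support⇒just : ∀ {f k} → k ∈ support f → ∃ λ a → f k ≡ just a
  ∈support⇒just {f} {k} k∈ with f k | trans (sym (lookup∘tabulate (is-just ∘ f) k)) ([]=⇒lookup k∈)
  ... | just a  | _  = a , refl
  ... | nothing | ()

  ∉support⇒nothing : ∀ {f k} → k ∉ support f → f k ≡ nothing
  ∉support⇒nothing {f} {k} k∉ with f k in eq
  ... | nothing = refl
  ... | just _  = ⊥-elim (k∉ (just⇒∈support eq))

∃-∉ : ∀ {n} (p : Subset n) → ∣ p ∣ < n → ∃ λ k → k ∉ p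
∃-∉ (outside ∷ p) _       = zero , λ ()
∃-∉ (inside ∷ p)  (s≤s lt) with ∃-∉ p lt
... | k , k∉ = suc k , λ { (there k∈) → k∉ k∈ }

n∸t≤∣∁p∣ : ∀ {n t} (p : Subset n) → ∣ p ∣ ≤ t → n ∸ t ≤ ∣ ∁ p ∣
n∸t≤∣∁p∣ {n} {t} p ∣p∣≤t = subst (n ∸ t ≤_) (sym (∣∁p∣≡n∸∣p∣ p)) (∸-monoʳ-≤ n ∣p∣≤t)

module _ {n t : ℕ} {V : Set} {x : Fin n → V} (E : Execution n t V x) where
  open Execution E

  senders : Fin n → Subset n
  senders j = support (λ k → recv k j)

  entry-honest : ∀ {k j} ℓ → k ∉ C₂ → entry E k j ℓ ≡ just (v ℓ k)
  entry-honest {k} {j} ℓ k∉C₂ rewrite recv-honest k j k∉C₂ = refl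

  Cond⇒≡honest : ∀ {j ℓ b k} → Cond E j ℓ b → k ∉ C₂ → b ≡ v ℓ k
  Cond⇒≡honest {ℓ = ℓ} {k = k} (I , _ , inI , outI) k∉C₂ with k ∈? I
  ... | yes k∈I = just-injective (trans (sym (inI k k∈I)) (entry-honest ℓ k∉C₂))
  ... | no  k∉I with trans (sym (outI k k∉I)) (entry-honest ℓ k∉C₂)
  ...   | ()

  OutputRule⇒≡honest : ∀ {j ℓ y b k} → OutputRule E j ℓ y → y ≡ just b → k ∉ C₂ → b ≡ v ℓ k
  OutputRule⇒≡honest (inj₁ (_ , c , refl)) refl = Cond⇒≡honest c
  OutputRule⇒≡honest (inj₂ (_ , refl))     ()

  recv-uncorrupted : ∀ {k j w ℓ} → ℓ ∉ C₁ → recv k j ≡ just w → w ℓ ≡ x ℓ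
  recv-uncorrupted {k} {j} {w} {ℓ} ℓ∉C₁ eq with k ∈? C₂
  ... | yes k∈C₂ = recv-auth k j w k∈C₂ eq ℓ ℓ∉C₁
  ... | no  k∉C₂ = trans (cong (λ u → u ℓ) (just-injective (trans (sym eq) (recv-honest k j k∉C₂))))
                         (v-honest ℓ k ℓ∉C₁)

  ∁C₂⊆senders : ∀ j {k} → k ∈ ∁ C₂ → k ∈ senders j
  ∁C₂⊆senders j {k} k∈ = just⇒∈support (recv-honest k j (x∈∁p⇒x∉p k∈))

  Cond-uncorrupted : ∀ j {ℓ} → ℓ ∉ C₁ → Cond E j ℓ (x ℓ)
  Cond-uncorrupted j {ℓ} ℓ∉C₁ = senders j , size , in-senders , out-senders
    where
    size : n ∸ t ≤ ∣ senders j ∣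
    size = ≤-trans (n∸t≤∣∁p∣ C₂ C₂-size) (p⊆q⇒∣p∣≤∣q∣ (∁C₂⊆senders j))
    in-senders : ∀ k → k ∈ senders j → entry E k j ℓ ≡ just (x ℓ)
    in-senders k k∈ with ∈support⇒just k∈
    ... | _ , eq rewrite eq = cong just (recv-uncorrupted ℓ∉C₁ eq)
    out-senders : ∀ k → k ∉ senders j → entry E k j ℓ ≡ nothing
    out-senders k k∉ rewrite ∉support⇒nothing k∉ = refl

  module _ (t<n : t < n) where

    honest-sender₂ : ∃ λ k → k ∉ C₂
    honest-sender₂ = ∃-∉ C₂ (≤-<-trans C₂-size t<n)

    OutputRule-agreement : ∀ {i j ℓ y y′ b b′} → OutputRule E i ℓ y → OutputRule E j ℓ y′
                         → y ≡ just b → y′ ≡ just b′ → b ≡ b′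
    OutputRule-agreement rule rule′ eq eq′ with honest-sender₂
    ... | k , k∉C₂ = trans (OutputRule⇒≡honest rule eq k∉C₂) (sym (OutputRule⇒≡honest rule′ eq′ k∉C₂))

    OutputRule-validity : ∀ {j ℓ y} → ℓ ∉ C₁ → OutputRule E j ℓ y → y ≡ just (x ℓ)
    OutputRule-validity {ℓ = ℓ} ℓ∉C₁ (inj₁ (_ , c , refl)) with honest-sender₂
    ... | k , k∉C₂ = cong just (trans (Cond⇒≡honest c k∉C₂) (v-honest ℓ k ℓ∉C₁))
    OutputRule-validity {j} ℓ∉C₁ (inj₂ (no-b , _)) = ⊥-elim (no-b (x _ , Cond-uncorrupted j ℓ∉C₁))

-- Authentication makes t < n suffice; 2t < n is used only to obtain it.
theorem5p4 : (n t : ℕ) → 2 * t < n → (V : Set) → (x : Fin n → V)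
    → (E : Execution n t V x) → (y : Fin n → Fin n → Maybe V)
    → (∀ j ℓ → OutputRule E j ℓ (y j ℓ))
    → SolvesSM n t x y
theorem5p4 n t 2t<n V x E y rule =
  (∁ C₁ , n∸t≤∣∁p∣ C₁ C₁-size ,
     λ ℓ ℓ∈ i → OutputRule-validity E t<n (x∈∁p⇒x∉p ℓ∈) (rule i ℓ)) ,
  λ i j ℓ b b′ → OutputRule-agreement E t<n (rule i ℓ) (rule j ℓ)
  where
  open Execution E using (C₁; C₁-size)
  t<n : t < n
  t<n = ≤-<-trans (m≤m+n t _) 2t<n
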